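{- For $n\ge1$ let $V_n:=\sum_{w\in\mathcal F_{n,2}}\mathrm{ver}(G(w))$ be the total number of vertices of all graphs $G(w)$, $w\in\mathcal F_{n,2}$, and let $D^{(2)}_n:=\sum_{w\in\mathcal F_{n,2}}\deg_2(G(w))$ be the total number of vertices of degree $2$ among them. Then $$\lim_{n\to\infty}\frac{D^{(2)}_n}{V_n}=\frac{7-\sqrt5}{22}.$$
   Context: $\mathcal F_{n,2}$ is the set of binary words $w=w_1\cdots w_n$ with no two consecutive $1$'s. $P(w)$ is the bargraph polyomino formed by the unit squares $[i-1,i]\times[j-1,j]$, $1\le i\le n$, $1\le j\le w_i+1$. $G(w)$ is the graph whose vertices are the corners of the cells of $P(w)$ and whose edges are the cell sides. $\mathrm{ver}(G)$ is the number of vertices of $G$ and $\deg_2(G)$ the number of vertices of degree $2$. -}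

module Defs where

open import Data.Bool using (Bool; true; false; _∨_; _∧_; if_then_else_; not)
open import Data.Nat as ℕ using (ℕ; zero; suc; _<ᵇ_; _≡ᵇ_)
open import Data.List using (List; []; _∷_; [_]; concatMap; filterᵇ; map; upTo; length; cartesianProduct)
open import Data.Nat.ListAction using (sum)
open import Data.Product using (_×_; _,_)
open import Data.Sum using (_⊎_)
open import Data.Integer using (+_)
open import Data.Rational using (ℚ; _<_; _+_; _-_; _*_; 0ℚ; _/_)

-- all binary words of length n (true = letter 1, false = letter 0)
allWords : ℕ → List (List Bool)
allWords zero    = [ [] ]
allWords (suc n) = concatMap (λ w → (false ∷ w) ∷ (true ∷ w) ∷ []) (allWords n)

noTwoOnes : List Bool → Bool
noTwoOnes []                 = true
noTwoOnes (true ∷ true ∷ _)  = false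
noTwoOnes (true ∷ xs)        = noTwoOnes xs
noTwoOnes (false ∷ xs)       = noTwoOnes xs

F : ℕ → List (List Bool)
F n = filterᵇ noTwoOnes (allWords n)

-- The bargraph P(w) and the graph G(w)
-- Column a (0-based, a = i-1) has height w_i + 1.  The cell
-- [i-1,i] × [j-1,j] is indexed by its lower-left corner (i-1, j-1).

colHeight : List Bool → ℕ → ℕ
colHeight []       _       = 0
colHeight (x ∷ _)  zero    = if x then 2 else 1
colHeight (_ ∷ xs) (suc a) = colHeight xs a

cell : List Bool → ℕ → ℕ → Bool
cell w a b = b <ᵇ colHeight w a

-- cell with lower-left corner (a-1, b), (a, b-1), (a-1, b-1); false if a coordinate is negative
cellL : List Bool → ℕ → ℕ → Bool
cellL w zero    b = false
cellL w (suc a) b = cell w a b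

cellD : List Bool → ℕ → ℕ → Bool
cellD w a zero    = false
cellD w a (suc b) = cell w a b

cellLD : List Bool → ℕ → ℕ → Bool
cellLD w zero    b = false
cellLD w (suc a) b = cellD w a b

isVertex : List Bool → ℕ → ℕ → Bool
isVertex w x y = cell w x y ∨ cellL w x y ∨ cellD w x y ∨ cellLD w x y

-- edges of G(w) (= cell sides) incident to (x , y)
rightEdge : List Bool → ℕ → ℕ → Bool
rightEdge w x y = cell w x y ∨ cellD w x y

leftEdge : List Bool → ℕ → ℕ → Bool
leftEdge w x y = cellL w x y ∨ cellLD w x y

upEdge : List Bool → ℕ → ℕ → Bool
upEdge w x y = cell w x y ∨ cellL w x y

downEdge : List Bool → ℕ → ℕ → Bool
downEdge w x y = cellD w x y ∨ cellLD w x y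

b2n : Bool → ℕ
b2n true  = 1
b2n false = 0

degree : List Bool → ℕ → ℕ → ℕ
degree w x y = b2n (rightEdge w x y) ℕ.+ b2n (leftEdge w x y)
               ℕ.+ b2n (upEdge w x y) ℕ.+ b2n (downEdge w x y)

-- all lattice points that can possibly be corners: 0 ≤ x ≤ n, 0 ≤ y ≤ 3
grid : List Bool → List (ℕ × ℕ)
grid w = cartesianProduct (upTo (suc (length w))) (upTo 4)

countᵇ : {A : Set} → (A → Bool) → List A → ℕ
countᵇ p xs = sum (map (λ a → b2n (p a)) xs)

ver : List Bool → ℕ
ver w = countᵇ (λ { (x , y) → isVertex w x y }) (grid w)

deg₂ : List Bool → ℕ
deg₂ w = countᵇ (λ { (x , y) → isVertex w x y ∧ (degree w x y ≡ᵇ 2) }) (grid w)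

V : ℕ → ℕ
V n = sum (map ver (F n))

D₂ : ℕ → ℕ
D₂ n = sum (map deg₂ (F n))

ℚ5 ℚ7 ℚ22 : ℚ
ℚ5  = + 5 / 1
ℚ7  = + 7 / 1
ℚ22 = + 22 / 1

_<√5 : ℚ → Set
q <√5 = q < 0ℚ ⊎ q * q < ℚ5

√5<_ : ℚ → Set
√5< q = (0ℚ < q) × (ℚ5 < q * q)

-- r < (7 - √5)/22   ⟺   √5 < 7 - 22 r
_<L : ℚ → Set
r <L = √5< (ℚ7 - ℚ22 * r)

-- (7 - √5)/22 < r   ⟺   7 - 22 r < √5
L<_ : ℚ → Set
L< r = (ℚ7 - ℚ22 * r) <√5

WithinL : ℚ → ℚ → Set
WithinL ε r = L< (r + ε) × (r - ε) <L

{-# OPTIONS --safe #-}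
-- The vertices of G(w) on a vertical grid line depend only on the heights of the two columns
-- beside it, so ver and deg₂ are sums of a local weight over consecutive letters of w. Splitting
-- F_{n+2} into 0·F_{n+1} and 10·F_n turns V_n and D_n into Fibonacci-type recurrences with
--   5 V_n = n (14 F_n + 12 F_{n+1}) + 14 F_n + 10 F_{n+1},
--   5 D_n = n (4 F_n + 2 F_{n+1}) + 14 F_n + 20 F_{n+1}.
-- Hence 7 − 22 D_n / V_n = T / U with T, U linear in n, and by Cassini's identity
-- |T² − 5 U²| = O(n F_{n+1}²) while U² ≥ n² F_{n+1}², so (T / U)² → 5. Clearing denominators
-- reduces the two halves of the Dedekind-cut comparison with √5 to inequalities between naturals.
module Submission where

open import Defs

module Counting where

  open import Data.Bool using (Bool; true; false; if_then_else_; _∨_; _∧_)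
  open import Data.Nat using (ℕ; zero; suc; _+_; _*_; _<ᵇ_; _≡ᵇ_)
  open import Data.Nat.Properties using (+-identityʳ; +-assoc; *-identityˡ; *-zeroʳ; *-suc)
  open import Data.Nat.ListAction using (sum)
  open import Data.Nat.ListAction.Properties using (sum-++)
  open import Data.List using (List; []; _∷_; _++_; map; length; filterᵇ; concatMap; upTo; applyUpTo; cartesianProduct)
  open import Data.List.Properties using (map-++; map-cong; map-∘; map-applyUpTo)
  open import Data.Product using (_×_; _,_; uncurry)
  open import Function using (_∘_)
  open import Relation.Binary.PropositionalEquality
  open import Data.Nat.Tactic.RingSolver using (solve-∀)
  open ≡-Reasoning

  sum-map-cong : ∀ {A : Set} {f g : A → ℕ} → (∀ x → f x ≡ g x) → ∀ xs → sum (map f xs) ≡ sum (map g xs)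
  sum-map-cong f≗g xs = cong sum (map-cong f≗g xs)

  sum-map-++ : ∀ {A : Set} (f : A → ℕ) xs ys → sum (map f (xs ++ ys)) ≡ sum (map f xs) + sum (map f ys)
  sum-map-++ f xs ys = trans (cong sum (map-++ f xs ys)) (sum-++ (map f xs) (map f ys))

  sum-map-+ : ∀ {A : Set} (f g : A → ℕ) xs → sum (map (λ x → f x + g x) xs) ≡ sum (map f xs) + sum (map g xs)
  sum-map-+ f g []       = refl
  sum-map-+ f g (x ∷ xs) = begin
    f x + g x + sum (map (λ x → f x + g x) xs)       ≡⟨ cong (f x + g x +_) (sum-map-+ f g xs) ⟩
    f x + g x + (sum (map f xs) + sum (map g xs))     ≡⟨ shuffle (f x) (g x) (sum (map f xs)) (sum (map g xs)) ⟩
    f x + sum (map f xs) + (g x + sum (map g xs))     ∎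
    where
    shuffle : ∀ a b c d → a + b + (c + d) ≡ a + c + (b + d)
    shuffle = solve-∀

  sum-map-const : ∀ {A : Set} c (xs : List A) → sum (map (λ _ → c) xs) ≡ c * length xs
  sum-map-const c []       = sym (*-zeroʳ c)
  sum-map-const c (x ∷ xs) = trans (cong (c +_) (sum-map-const c xs)) (sym (*-suc c (length xs)))

  sum-map-cartesianProduct : ∀ {A B : Set} (f : A × B → ℕ) xs ys →
    sum (map f (cartesianProduct xs ys)) ≡ sum (map (λ x → sum (map (λ y → f (x , y)) ys)) xs)
  sum-map-cartesianProduct f []       ys = refl
  sum-map-cartesianProduct f (x ∷ xs) ys = begin
    sum (map f (map (x ,_) ys ++ cartesianProduct xs ys))
      ≡⟨ sum-map-++ f (map (x ,_) ys) (cartesianProduct xs ys) ⟩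
    sum (map f (map (x ,_) ys)) + sum (map f (cartesianProduct xs ys))
      ≡⟨ cong₂ _+_ (cong sum (sym (map-∘ ys))) (sum-map-cartesianProduct f xs ys) ⟩
    sum (map (λ y → f (x , y)) ys) + sum (map (λ x → sum (map (λ y → f (x , y)) ys)) xs) ∎

  height : Bool → ℕ
  height b = if b then 2 else 1

  filled : ℕ → ℕ → Bool
  filled h y = y <ᵇ h

  filledBelow : ℕ → ℕ → Bool
  filledBelow h zero    = false
  filledBelow h (suc y) = filled h y

  -- isVertex and degree of Defs at height y on a vertical grid line, in terms of the heights hL, hR
  -- of the columns to its left and right (0 where there is no column).
  isVertexBetween : ℕ → ℕ → ℕ → Bool
  isVertexBetween hL hR y = filled hR y ∨ filled hL y ∨ filledBelow hR y ∨ filledBelow hL y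

  degreeBetween : ℕ → ℕ → ℕ → ℕ
  degreeBetween hL hR y = b2n (filled hR y ∨ filledBelow hR y) + b2n (filled hL y ∨ filledBelow hL y)
                        + b2n (filled hR y ∨ filled hL y) + b2n (filledBelow hR y ∨ filledBelow hL y)

  lineCount : (ℕ → ℕ → ℕ → Bool) → ℕ → ℕ → ℕ
  lineCount P hL hR = countᵇ (P hL hR) (upTo 4)

  isDegree₂Between : ℕ → ℕ → ℕ → Bool
  isDegree₂Between hL hR y = isVertexBetween hL hR y ∧ (degreeBetween hL hR y ≡ᵇ 2)

  vertexCount degree₂Count : ℕ → ℕ → ℕ
  vertexCount  = lineCount isVertexBetween
  degree₂Count = lineCount isDegree₂Between

  -- lineSum φ h₀ w adds φ hL hR over the vertical lines x = 0, …, length w, where h₀ stands for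
  -- the height left of line 0; leftHeight gives the hL of line x.
  leftHeight : ℕ → List Bool → ℕ → ℕ
  leftHeight h₀ w zero    = h₀
  leftHeight h₀ w (suc x) = colHeight w x

  lineSum : (ℕ → ℕ → ℕ) → ℕ → List Bool → ℕ
  lineSum φ hL []      = φ hL 0
  lineSum φ hL (b ∷ w) = φ hL (height b) + lineSum φ (height b) w

  sum-lines≡lineSum : ∀ φ h₀ w (c : ℕ → ℕ) → (∀ x → c x ≡ φ (leftHeight h₀ w x) (colHeight w x)) →
                      sum (applyUpTo c (suc (length w))) ≡ lineSum φ h₀ w
  sum-lines≡lineSum φ h₀ []      c c≗ = trans (+-identityʳ (c 0)) (c≗ 0)
  sum-lines≡lineSum φ h₀ (b ∷ w) c c≗ = cong₂ _+_ (c≗ 0) (sum-lines≡lineSum φ (height b) w (c ∘ suc) c∘suc≗)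
    where
    c∘suc≗ : ∀ x → c (suc x) ≡ φ (leftHeight (height b) w x) (colHeight w x)
    c∘suc≗ zero    = c≗ 1
    c∘suc≗ (suc x) = c≗ (suc (suc x))

  countᵇ-grid≡lineSum : ∀ (P : ℕ → ℕ → ℕ → Bool) (Q : List Bool → ℕ → ℕ → Bool) →
    (∀ w x → countᵇ (Q w x) (upTo 4) ≡ lineCount P (leftHeight 0 w x) (colHeight w x)) →
    ∀ w → countᵇ (uncurry (Q w)) (grid w) ≡ lineSum (lineCount P) 0 w
  countᵇ-grid≡lineSum P Q Q≗P w = begin
    countᵇ (uncurry (Q w)) (grid w)
      ≡⟨ sum-map-cartesianProduct (b2n ∘ uncurry (Q w)) (upTo (suc (length w))) (upTo 4) ⟩
    sum (map (λ x → countᵇ (Q w x) (upTo 4)) (upTo (suc (length w))))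
      ≡⟨ cong sum (map-applyUpTo (λ x → x) (λ x → countᵇ (Q w x) (upTo 4)) (suc (length w))) ⟩
    sum (applyUpTo (λ x → countᵇ (Q w x) (upTo 4)) (suc (length w)))
      ≡⟨ sum-lines≡lineSum (lineCount P) 0 w _ (Q≗P w) ⟩
    lineSum (lineCount P) 0 w ∎

  ver≡lineSum : ∀ w → ver w ≡ lineSum vertexCount 0 w
  ver≡lineSum = countᵇ-grid≡lineSum isVertexBetween isVertex columns
    where
    columns : ∀ w x → countᵇ (isVertex w x) (upTo 4) ≡ vertexCount (leftHeight 0 w x) (colHeight w x)
    columns w zero    = refl
    columns w (suc x) = refl

  deg₂≡lineSum : ∀ w → deg₂ w ≡ lineSum degree₂Count 0 w
  deg₂≡lineSum = countᵇ-grid≡lineSum isDegree₂Between (λ w x y → isVertex w x y ∧ (degree w x y ≡ᵇ 2)) columns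
    where
    columns : ∀ w x → countᵇ (λ y → isVertex w x y ∧ (degree w x y ≡ᵇ 2)) (upTo 4)
                    ≡ degree₂Count (leftHeight 0 w x) (colHeight w x)
    columns w zero    = refl
    columns w (suc x) = refl

  sumF : ℕ → (List Bool → ℕ) → ℕ
  sumF n g = sum (map g (F n))

  sum-map-filterᵇ : ∀ {A : Set} (p : A → Bool) (g : A → ℕ) xs →
    sum (map g (filterᵇ p xs)) ≡ sum (map (λ x → if p x then g x else 0) xs)
  sum-map-filterᵇ p g []       = refl
  sum-map-filterᵇ p g (x ∷ xs) with p x
  ... | true  = cong (g x +_) (sum-map-filterᵇ p g xs)
  ... | false = sum-map-filterᵇ p g xs

  sum-allWords-suc : ∀ n (h : List Bool → ℕ) →
    sum (map h (allWords (suc n))) ≡ sum (map (λ w → h (false ∷ w) + h (true ∷ w)) (allWords n))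
  sum-allWords-suc n h = go (allWords n)
    where
    go : ∀ ws → sum (map h (concatMap (λ w → (false ∷ w) ∷ (true ∷ w) ∷ []) ws))
              ≡ sum (map (λ w → h (false ∷ w) + h (true ∷ w)) ws)
    go []       = refl
    go (w ∷ ws) = trans (cong (λ s → h (false ∷ w) + (h (true ∷ w) + s)) (go ws))
                        (sym (+-assoc (h (false ∷ w)) (h (true ∷ w)) _))

  restrict : (List Bool → ℕ) → List Bool → ℕ
  restrict g w = if noTwoOnes w then g w else 0

  sumF-suc-suc : ∀ n g → sumF (suc (suc n)) g ≡ sumF (suc n) (g ∘ (false ∷_)) + sumF n (g ∘ (true ∷_) ∘ (false ∷_))
  sumF-suc-suc n g = begin
    sumF (suc (suc n)) g
      ≡⟨ sum-map-filterᵇ noTwoOnes g (allWords (suc (suc n))) ⟩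
    sum (map (restrict g) (allWords (suc (suc n))))
      ≡⟨ sum-allWords-suc (suc n) (restrict g) ⟩
    sum (map (λ w → restrict g (false ∷ w) + restrict g (true ∷ w)) (allWords (suc n)))
      ≡⟨ sum-map-+ (restrict (g ∘ (false ∷_))) (restrict g ∘ (true ∷_)) (allWords (suc n)) ⟩
    sum (map (restrict (g ∘ (false ∷_))) (allWords (suc n))) + sum (map (restrict g ∘ (true ∷_)) (allWords (suc n)))
      ≡⟨ cong (sum (map (restrict (g ∘ (false ∷_))) (allWords (suc n))) +_) startsWith1 ⟩
    sum (map (restrict (g ∘ (false ∷_))) (allWords (suc n))) + sum (map (restrict (g ∘ (true ∷_) ∘ (false ∷_))) (allWords n))
      ≡⟨ sym (cong₂ _+_ (sum-map-filterᵇ noTwoOnes _ (allWords (suc n))) (sum-map-filterᵇ noTwoOnes _ (allWords n))) ⟩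
    sumF (suc n) (g ∘ (false ∷_)) + sumF n (g ∘ (true ∷_) ∘ (false ∷_)) ∎
    where
    startsWith1 : sum (map (restrict g ∘ (true ∷_)) (allWords (suc n)))
                ≡ sum (map (restrict (g ∘ (true ∷_) ∘ (false ∷_))) (allWords n))
    startsWith1 = trans (sum-allWords-suc n (restrict g ∘ (true ∷_)))
                        (sum-map-cong (λ w → +-identityʳ _) (allWords n))

  sumF-const+ : ∀ n c g → sumF n (λ w → c + g w) ≡ c * length (F n) + sumF n g
  sumF-const+ n c g = trans (sum-map-+ (λ _ → c) g (F n)) (cong (_+ sumF n g) (sum-map-const c (F n)))

  fib : ℕ → ℕ
  fib 0             = 0
  fib 1             = 1
  fib (suc (suc n)) = fib (suc n) + fib n

  length-F : ∀ n → length (F n) ≡ fib (suc (suc n))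
  length-F 0             = refl
  length-F 1             = refl
  length-F (suc (suc n)) = begin
    length (F (suc (suc n)))                         ≡⟨ sym (count (suc (suc n))) ⟩
    sumF (suc (suc n)) (λ _ → 1)                    ≡⟨ sumF-suc-suc n (λ _ → 1) ⟩
    sumF (suc n) (λ _ → 1) + sumF n (λ _ → 1)       ≡⟨ cong₂ _+_ (count (suc n)) (count n) ⟩
    length (F (suc n)) + length (F n)                ≡⟨ cong₂ _+_ (length-F (suc n)) (length-F n) ⟩
    fib (suc (suc (suc n))) + fib (suc (suc n))      ∎
    where
    count : ∀ m → sumF m (λ _ → 1) ≡ length (F m)
    count m = trans (sum-map-const 1 (F m)) (*-identityˡ (length (F m)))

  lineTotal : (ℕ → ℕ → ℕ) → ℕ → ℕ → ℕ
  lineTotal φ h₀ n = sumF n (lineSum φ h₀)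

  lineTotal-suc-suc : ∀ φ h₀ n → lineTotal φ h₀ (suc (suc n)) ≡
    lineTotal φ 1 (suc n) + lineTotal φ 1 n + (φ h₀ 1 * fib (3 + n) + (φ h₀ 2 + φ 2 1) * fib (2 + n))
  lineTotal-suc-suc φ h₀ n = begin
    lineTotal φ h₀ (suc (suc n))
      ≡⟨ sumF-suc-suc n (lineSum φ h₀) ⟩
    sumF (suc n) (λ w → φ h₀ 1 + lineSum φ 1 w) + sumF n (λ w → φ h₀ 2 + (φ 2 1 + lineSum φ 1 w))
      ≡⟨ cong (sumF (suc n) (λ w → φ h₀ 1 + lineSum φ 1 w) +_)
              (sum-map-cong (λ w → sym (+-assoc (φ h₀ 2) (φ 2 1) (lineSum φ 1 w))) (F n)) ⟩
    sumF (suc n) (λ w → φ h₀ 1 + lineSum φ 1 w) + sumF n (λ w → φ h₀ 2 + φ 2 1 + lineSum φ 1 w)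
      ≡⟨ cong₂ _+_ (sumF-const+ (suc n) (φ h₀ 1) (lineSum φ 1)) (sumF-const+ n (φ h₀ 2 + φ 2 1) (lineSum φ 1)) ⟩
    φ h₀ 1 * length (F (suc n)) + lineTotal φ 1 (suc n) + ((φ h₀ 2 + φ 2 1) * length (F n) + lineTotal φ 1 n)
      ≡⟨ cong₂ (λ u v → φ h₀ 1 * u + lineTotal φ 1 (suc n) + ((φ h₀ 2 + φ 2 1) * v + lineTotal φ 1 n))
               (length-F (suc n)) (length-F n) ⟩
    φ h₀ 1 * fib (3 + n) + lineTotal φ 1 (suc n) + ((φ h₀ 2 + φ 2 1) * fib (2 + n) + lineTotal φ 1 n)
      ≡⟨ shuffle (φ h₀ 1 * fib (3 + n)) (lineTotal φ 1 (suc n)) ((φ h₀ 2 + φ 2 1) * fib (2 + n)) (lineTotal φ 1 n) ⟩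
    lineTotal φ 1 (suc n) + lineTotal φ 1 n + (φ h₀ 1 * fib (3 + n) + (φ h₀ 2 + φ 2 1) * fib (2 + n)) ∎
    where
    shuffle : ∀ a b c d → a + b + (c + d) ≡ b + d + (a + c)
    shuffle = solve-∀

  5*lineTotal-suc-suc : ∀ φ h₀ n → 5 * lineTotal φ h₀ (2 + n) ≡
    5 * lineTotal φ 1 (1 + n) + 5 * lineTotal φ 1 n + 5 * (φ h₀ 1 * fib (3 + n) + (φ h₀ 2 + φ 2 1) * fib (2 + n))
  5*lineTotal-suc-suc φ h₀ n = trans (cong (5 *_) (lineTotal-suc-suc φ h₀ n))
    (distrib (lineTotal φ 1 (1 + n)) (lineTotal φ 1 n) (φ h₀ 1 * fib (3 + n) + (φ h₀ 2 + φ 2 1) * fib (2 + n)))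
    where
    distrib : ∀ a b c → 5 * (a + b + c) ≡ 5 * a + 5 * b + 5 * c
    distrib = solve-∀

  fibRecurrence-unique : ∀ (g x y : ℕ → ℕ) → x 0 ≡ y 0 → x 1 ≡ y 1 →
    (∀ n → x (2 + n) ≡ x (1 + n) + x n + g n) → (∀ n → y (2 + n) ≡ y (1 + n) + y n + g n) →
    ∀ n → x n ≡ y n
  fibRecurrence-unique g x y x₀ x₁ x-rec y-rec = go
    where
    go : ∀ n → x n ≡ y n
    go 0             = x₀
    go 1             = x₁
    go (suc (suc n)) = trans (x-rec n) (trans (cong₂ (λ u v → u + v + g n) (go (suc n)) (go n)) (sym (y-rec n)))

  fibLinear : ℕ → ℕ → ℕ → ℕ → ℕ → ℕ
  fibLinear p q r s n = n * (p * fib n + q * fib (suc n)) + r * fib n + s * fib (suc n)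

  5*lineTotal≡fibLinear : ∀ φ p q r s →
    5 * lineTotal φ 1 0 ≡ fibLinear p q r s 0 → 5 * lineTotal φ 1 1 ≡ fibLinear p q r s 1 →
    (∀ n → fibLinear p q r s (2 + n) ≡ fibLinear p q r s (1 + n) + fibLinear p q r s n
                                         + 5 * (φ 1 1 * fib (3 + n) + (φ 1 2 + φ 2 1) * fib (2 + n))) →
    ∀ n → 5 * lineTotal φ 1 n ≡ fibLinear p q r s n
  5*lineTotal≡fibLinear φ p q r s base₀ base₁ =
    fibRecurrence-unique (λ n → 5 * (φ 1 1 * fib (3 + n) + (φ 1 2 + φ 2 1) * fib (2 + n)))
                         (λ n → 5 * lineTotal φ 1 n) (fibLinear p q r s) base₀ base₁ (5*lineTotal-suc-suc φ 1)

  fibLinear-vertex-rec : ∀ n → fibLinear 14 12 14 10 (2 + n) ≡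
    fibLinear 14 12 14 10 (1 + n) + fibLinear 14 12 14 10 n + 5 * (2 * fib (3 + n) + 6 * fib (2 + n))
  fibLinear-vertex-rec n = identity n (fib n) (fib (suc n))
    where
    identity : ∀ n a b →
      (2 + n) * (14 * (b + a) + 12 * (b + a + b)) + 14 * (b + a) + 10 * (b + a + b)
        ≡ (1 + n) * (14 * b + 12 * (b + a)) + 14 * b + 10 * (b + a) + (n * (14 * a + 12 * b) + 14 * a + 10 * b)
          + 5 * (2 * (b + a + b) + 6 * (b + a))
    identity = solve-∀

  fibLinear-degree₂-rec : ∀ n → fibLinear 4 2 9 10 (2 + n) ≡
    fibLinear 4 2 9 10 (1 + n) + fibLinear 4 2 9 10 n + 5 * (0 * fib (3 + n) + 2 * fib (2 + n))
  fibLinear-degree₂-rec n = identity n (fib n) (fib (suc n))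
    where
    identity : ∀ n a b →
      (2 + n) * (4 * (b + a) + 2 * (b + a + b)) + 9 * (b + a) + 10 * (b + a + b)
        ≡ (1 + n) * (4 * b + 2 * (b + a)) + 9 * b + 10 * (b + a) + (n * (4 * a + 2 * b) + 9 * a + 10 * b)
          + 5 * (0 * (b + a + b) + 2 * (b + a))
    identity = solve-∀

  fibLinear-D₂-rec : ∀ n → fibLinear 4 2 14 20 (2 + n) ≡
    fibLinear 4 2 9 10 (1 + n) + fibLinear 4 2 9 10 n + 5 * (2 * fib (3 + n) + 3 * fib (2 + n))
  fibLinear-D₂-rec n = identity n (fib n) (fib (suc n))
    where
    identity : ∀ n a b →
      (2 + n) * (4 * (b + a) + 2 * (b + a + b)) + 14 * (b + a) + 20 * (b + a + b)
        ≡ (1 + n) * (4 * b + 2 * (b + a)) + 9 * b + 10 * (b + a) + (n * (4 * a + 2 * b) + 9 * a + 10 * b)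
          + 5 * (2 * (b + a + b) + 3 * (b + a))
    identity = solve-∀

  5*lineTotal-vertexCount : ∀ n → 5 * lineTotal vertexCount 1 n ≡ fibLinear 14 12 14 10 n
  5*lineTotal-vertexCount = 5*lineTotal≡fibLinear vertexCount 14 12 14 10 refl refl fibLinear-vertex-rec

  5*lineTotal-degree₂Count : ∀ n → 5 * lineTotal degree₂Count 1 n ≡ fibLinear 4 2 9 10 n
  5*lineTotal-degree₂Count = 5*lineTotal≡fibLinear degree₂Count 4 2 9 10 refl refl fibLinear-degree₂-rec

  5*lineTotal₀-suc-suc : ∀ φ p q r s → (∀ n → 5 * lineTotal φ 1 n ≡ fibLinear p q r s n) →
    ∀ n → 5 * lineTotal φ 0 (2 + n) ≡
          fibLinear p q r s (1 + n) + fibLinear p q r s n + 5 * (φ 0 1 * fib (3 + n) + (φ 0 2 + φ 2 1) * fib (2 + n))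
  5*lineTotal₀-suc-suc φ p q r s closed n =
    trans (5*lineTotal-suc-suc φ 0 n)
          (cong₂ (λ u v → u + v + 5 * (φ 0 1 * fib (3 + n) + (φ 0 2 + φ 2 1) * fib (2 + n))) (closed (1 + n)) (closed n))

  5*V≡fibLinear : ∀ n → 5 * V (suc n) ≡ fibLinear 14 12 14 10 (suc n)
  5*V≡fibLinear 0       = refl
  5*V≡fibLinear (suc n) = begin
    5 * V (2 + n)                        ≡⟨ cong (5 *_) (sum-map-cong ver≡lineSum (F (2 + n))) ⟩
    5 * lineTotal vertexCount 0 (2 + n)  ≡⟨ 5*lineTotal₀-suc-suc vertexCount 14 12 14 10 5*lineTotal-vertexCount n ⟩
    _                                    ≡⟨ fibLinear-vertex-rec n ⟨
    fibLinear 14 12 14 10 (2 + n)        ∎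

  5*D₂≡fibLinear : ∀ n → 5 * D₂ (suc n) ≡ fibLinear 4 2 14 20 (suc n)
  5*D₂≡fibLinear 0       = refl
  5*D₂≡fibLinear (suc n) = begin
    5 * D₂ (2 + n)                        ≡⟨ cong (5 *_) (sum-map-cong deg₂≡lineSum (F (2 + n))) ⟩
    5 * lineTotal degree₂Count 0 (2 + n)  ≡⟨ 5*lineTotal₀-suc-suc degree₂Count 4 2 9 10 5*lineTotal-degree₂Count n ⟩
    _                                     ≡⟨ fibLinear-D₂-rec n ⟨
    fibLinear 4 2 14 20 (2 + n)           ∎

module Asymptotics where

  open import Data.Nat
  open import Data.Nat.Properties
  open import Data.Product using (Σ; _×_; _,_)
  open import Relation.Binary.PropositionalEquality
  open import Data.Nat.Tactic.RingSolver using (solve-∀)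
  open Counting using (fib; fibLinear; 5*V≡fibLinear; 5*D₂≡fibLinear)

  Near√5 : ℕ → ℕ → ℕ → Set
  Near√5 B t v = B * (t * t) < 5 * B * (v * v) + 22 * (v * v) × 5 * B * (v * v) < B * (t * t) + 22 * (v * v)

  near√5-byDefect : ∀ B t v L R → t * t + L ≡ 5 * (v * v) + R → B * (L + R) < 22 * (v * v) → Near√5 B t v
  near√5-byDefect B t v L R balance small = below , above
    where
    open ≤-Reasoning
    scaled : B * (t * t + L) ≡ 5 * B * (v * v) + B * R
    scaled = trans (cong (B *_) balance) (distrib B (v * v) R)
      where
      distrib : ∀ x y z → x * (5 * y + z) ≡ 5 * x * y + x * z
      distrib = solve-∀
    below : B * (t * t) < 5 * B * (v * v) + 22 * (v * v)
    below = begin-strict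
      B * (t * t)                     ≤⟨ *-monoʳ-≤ B (m≤m+n (t * t) L) ⟩
      B * (t * t + L)                 ≡⟨ scaled ⟩
      5 * B * (v * v) + B * R         ≤⟨ +-monoʳ-≤ (5 * B * (v * v)) (*-monoʳ-≤ B (m≤n+m R L)) ⟩
      5 * B * (v * v) + B * (L + R)   <⟨ +-monoʳ-< (5 * B * (v * v)) small ⟩
      5 * B * (v * v) + 22 * (v * v)  ∎
    above : 5 * B * (v * v) < B * (t * t) + 22 * (v * v)
    above = begin-strict
      5 * B * (v * v)                 ≤⟨ m≤m+n (5 * B * (v * v)) (B * R) ⟩
      5 * B * (v * v) + B * R         ≡⟨ sym scaled ⟩
      B * (t * t + L)                 ≡⟨ *-distribˡ-+ B (t * t) L ⟩
      B * (t * t) + B * L             ≤⟨ +-monoʳ-≤ (B * (t * t)) (*-monoʳ-≤ B (m≤m+n L R)) ⟩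
      B * (t * t) + B * (L + R)       <⟨ +-monoʳ-< (B * (t * t)) small ⟩
      B * (t * t) + 22 * (v * v)      ∎

  near√5-bracket : ∀ B t v A .{{_ : NonZero B}} → 1 ≤ A → v ≤ t → Near√5 B t v →
    (∀ z → t * B ≡ z + 22 * A * v → z * z < 5 * ((v * B) * (v * B))) ×
    5 * ((v * B) * (v * B)) < (t * B + 22 * A * v) * (t * B + 22 * A * v)
  near√5-bracket B t v A 1≤A v≤t (below , above) = lower , upper
    where
    open ≤-Reasoning
    K = 22 * A * v
    vB≤tB : v * B ≤ t * B
    vB≤tB = *-monoˡ-≤ B v≤t
    22Bv²≤KvB : 22 * B * (v * v) ≤ K * (v * B)
    22Bv²≤KvB = begin
      22 * B * (v * v)       ≡⟨ reorder B v ⟩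
      22 * 1 * v * (v * B)   ≤⟨ *-monoˡ-≤ (v * B) (*-monoˡ-≤ v (*-monoʳ-≤ 22 1≤A)) ⟩
      K * (v * B)            ∎
      where
      reorder : ∀ B v → 22 * B * (v * v) ≡ 22 * 1 * v * (v * B)
      reorder = solve-∀
    lower : ∀ z → t * B ≡ z + K → z * z < 5 * ((v * B) * (v * B))
    lower z tB≡z+K = +-cancelʳ-< (K * (v * B)) (z * z) (5 * ((v * B) * (v * B))) (begin-strict
      z * z + K * (v * B)                ≤⟨ +-monoʳ-≤ (z * z) (*-monoʳ-≤ K vB≤tB) ⟩
      z * z + K * (t * B)                ≡⟨ cong (λ y → z * z + K * y) tB≡z+K ⟩
      z * z + K * (z + K)                ≤⟨ +-monoˡ-≤ (K * (z + K)) (m≤m+n (z * z) (K * z)) ⟩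
      z * z + K * z + K * (z + K)        ≡⟨ square-sum z K ⟩
      (z + K) * (z + K)                  ≡⟨ cong₂ _*_ tB≡z+K tB≡z+K ⟨
      (t * B) * (t * B)                  ≡⟨ reorder t B ⟩
      B * (B * (t * t))                  <⟨ *-monoʳ-< B below ⟩
      B * (5 * B * (v * v) + 22 * (v * v)) ≡⟨ distrib B v ⟩
      5 * ((v * B) * (v * B)) + 22 * B * (v * v) ≤⟨ +-monoʳ-≤ (5 * ((v * B) * (v * B))) 22Bv²≤KvB ⟩
      5 * ((v * B) * (v * B)) + K * (v * B) ∎)
      where
      square-sum : ∀ z K → z * z + K * z + K * (z + K) ≡ (z + K) * (z + K)
      square-sum = solve-∀
      reorder : ∀ t B → (t * B) * (t * B) ≡ B * (B * (t * t))
      reorder = solve-∀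
      distrib : ∀ B v → B * (5 * B * (v * v) + 22 * (v * v)) ≡ 5 * ((v * B) * (v * B)) + 22 * B * (v * v)
      distrib = solve-∀
    upper : 5 * ((v * B) * (v * B)) < (t * B + K) * (t * B + K)
    upper = begin-strict
      5 * ((v * B) * (v * B))              ≡⟨ reorder B v ⟩
      B * (5 * B * (v * v))                <⟨ *-monoʳ-< B above ⟩
      B * (B * (t * t) + 22 * (v * v))     ≡⟨ distrib t B v ⟩
      (t * B) * (t * B) + 22 * B * (v * v) ≤⟨ +-monoʳ-≤ ((t * B) * (t * B)) (≤-trans 22Bv²≤KvB (*-monoʳ-≤ K vB≤tB)) ⟩
      (t * B) * (t * B) + K * (t * B)      ≤⟨ m≤m+n _ (K * (t * B + K)) ⟩
      (t * B) * (t * B) + K * (t * B) + K * (t * B + K) ≡⟨ square-sum (t * B) K ⟩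
      (t * B + K) * (t * B + K)            ∎
      where
      reorder : ∀ B v → 5 * ((v * B) * (v * B)) ≡ B * (5 * B * (v * v))
      reorder = solve-∀
      distrib : ∀ t B v → B * (B * (t * t) + 22 * (v * v)) ≡ (t * B) * (t * B) + 22 * B * (v * v)
      distrib = solve-∀
      square-sum : ∀ y K → y * y + K * y + K * (y + K) ≡ (y + K) * (y + K)
      square-sum = solve-∀

  fib-mono : ∀ n → fib n ≤ fib (suc n)
  fib-mono zero    = z≤n
  fib-mono (suc n) = m≤m+n (fib (suc n)) (fib n)

  fib-suc-pos : ∀ n → 1 ≤ fib (suc n)
  fib-suc-pos zero    = s≤s z≤n
  fib-suc-pos (suc n) = ≤-trans (fib-suc-pos n) (fib-mono (suc n))

  n≤fib-suc : ∀ n → n ≤ fib (suc n)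
  n≤fib-suc zero          = z≤n
  n≤fib-suc (suc zero)    = s≤s z≤n
  n≤fib-suc (suc (suc n)) = subst (_≤ fib (3 + n)) (+-comm (suc n) 1) (+-mono-≤ (n≤fib-suc (suc n)) (fib-suc-pos n))

  -- b² − a b − a² = δ′ − δ = ±1 for a = fib n, b = fib (suc n).
  cassini : ∀ n → Σ ℕ λ δ → Σ ℕ λ δ′ →
    δ + δ′ ≡ 1 × fib (suc n) * fib (suc n) + δ ≡ fib n * fib (suc n) + fib n * fib n + δ′
  cassini zero    = 0 , 1 , refl , refl
  cassini (suc n) with cassini n
  ... | δ , δ′ , δ+δ′≡1 , identity = δ′ , δ , trans (+-comm δ′ δ) δ+δ′≡1 , step (fib n) (fib (suc n)) identity
    where
    step : ∀ a b → b * b + δ ≡ a * b + a * a + δ′ → (b + a) * (b + a) + δ′ ≡ b * (b + a) + b * b + δ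
    step a b h = +-cancelʳ-≡ (a * b + a * a + δ′) _ _
      (trans (cong ((b + a) * (b + a) + δ′ +_) (sym h)) (expand a b δ δ′))
      where
      expand : ∀ a b δ δ′ → (b + a) * (b + a) + δ′ + (b * b + δ) ≡ b * (b + a) + b * b + δ + (a * b + a * a + δ′)
      expand = solve-∀

  quadratic : ℕ → ℕ → ℕ → ℕ → ℕ → ℕ
  quadratic u v w a b = u * (a * a) + v * (a * b) + w * (b * b)

  -- Stated with symbolic coefficients because the ring solver is impractical on large numerals;
  -- concrete instances of these two lemmas are matched by evaluating the coefficients.
  product+quadratic : ∀ α β γ δ u v w a b →
    (α * a + β * b) * (γ * a + δ * b) + (u * (a * a) + v * (a * b) + w * (b * b))
      ≡ (α * γ + u) * (a * a) + (α * δ + β * γ + v) * (a * b) + (β * δ + w) * (b * b)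
  product+quadratic = solve-∀

  5*product+quadratic : ∀ α β γ δ u v w a b →
    5 * ((α * a + β * b) * (γ * a + δ * b)) + (u * (a * a) + v * (a * b) + w * (b * b))
      ≡ (5 * (α * γ) + u) * (a * a) + (5 * (α * δ + β * γ) + v) * (a * b) + (5 * (β * δ) + w) * (b * b)
  5*product+quadratic = solve-∀

  quadratic-+ : ∀ u v w u′ v′ w′ a b →
    (u * (a * a) + v * (a * b) + w * (b * b)) + (u′ * (a * a) + v′ * (a * b) + w′ * (b * b))
      ≡ (u + u′) * (a * a) + (v + v′) * (a * b) + (w + w′) * (b * b)
  quadratic-+ = solve-∀

  quadratic-bound : ∀ u v w {a b} → a ≤ b → quadratic u v w a b ≤ (u + v + w) * (b * b)
  quadratic-bound u v w {a} {b} a≤b = begin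
    u * (a * a) + v * (a * b) + w * (b * b)
      ≤⟨ +-monoˡ-≤ (w * (b * b)) (+-mono-≤ (*-monoʳ-≤ u (*-mono-≤ a≤b a≤b)) (*-monoʳ-≤ v (*-monoˡ-≤ b a≤b))) ⟩
    u * (b * b) + v * (b * b) + w * (b * b)
      ≡⟨ collect u v w (b * b) ⟩
    (u + v + w) * (b * b) ∎
    where
    open ≤-Reasoning
    collect : ∀ u v w z → u * z + v * z + w * z ≡ (u + v + w) * z
    collect = solve-∀

  pencil-defect : ∀ k P Q R S c₁ c₂ d₁ d₂ e₁ e₂ →
    P * P + c₁ ≡ 5 * (Q * Q) + c₂ → R * P + d₁ ≡ 5 * (S * Q) + d₂ → R * R + e₁ ≡ 5 * (S * S) + e₂ →
    (R + k * P) * (R + k * P) + (2 * k * d₁ + e₁ + k * k * c₁) ≡ 5 * ((S + k * Q) * (S + k * Q)) + (2 * k * d₂ + e₂ + k * k * c₂)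
  pencil-defect k P Q R S c₁ c₂ d₁ d₂ e₁ e₂ hPQ hRP hRS = begin
    (R + k * P) * (R + k * P) + (2 * k * d₁ + e₁ + k * k * c₁)
      ≡⟨ expand k P R c₁ d₁ e₁ ⟩
    (R * R + e₁) + 2 * k * (R * P + d₁) + k * k * (P * P + c₁)
      ≡⟨ cong₂ (λ x y → x + 2 * k * y + k * k * (P * P + c₁)) hRS hRP ⟩
    (5 * (S * S) + e₂) + 2 * k * (5 * (S * Q) + d₂) + k * k * (P * P + c₁)
      ≡⟨ cong (λ z → 5 * (S * S) + e₂ + 2 * k * (5 * (S * Q) + d₂) + k * k * z) hPQ ⟩
    (5 * (S * S) + e₂) + 2 * k * (5 * (S * Q) + d₂) + k * k * (5 * (Q * Q) + c₂)
      ≡⟨ collect k Q S c₂ d₂ e₂ ⟩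
    5 * ((S + k * Q) * (S + k * Q)) + (2 * k * d₂ + e₂ + k * k * c₂) ∎
    where
    open ≡-Reasoning
    expand : ∀ k P R c₁ d₁ e₁ → (R + k * P) * (R + k * P) + (2 * k * d₁ + e₁ + k * k * c₁)
                               ≡ (R * R + e₁) + 2 * k * (R * P + d₁) + k * k * (P * P + c₁)
    expand = solve-∀
    collect : ∀ k Q S c₂ d₂ e₂ → (5 * (S * S) + e₂) + 2 * k * (5 * (S * Q) + d₂) + k * k * (5 * (Q * Q) + c₂)
                                ≡ 5 * ((S + k * Q) * (S + k * Q)) + (2 * k * d₂ + e₂ + k * k * c₂)
    collect = solve-∀

  exchange-defect : ∀ X Y c p q δ δ′ → X + c * p ≡ Y + c * q → q + δ ≡ p + δ′ → X + c * δ ≡ Y + c * δ′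
  exchange-defect X Y c p q δ δ′ hXY hpq = +-cancelʳ-≡ (c * (q + δ)) _ _ (begin
    X + c * δ + c * (q + δ)       ≡⟨ cong (λ z → X + c * δ + c * z) hpq ⟩
    X + c * δ + c * (p + δ′)      ≡⟨ regroup X c p δ δ′ ⟩
    (X + c * p) + c * (δ + δ′)    ≡⟨ cong (_+ c * (δ + δ′)) hXY ⟩
    (Y + c * q) + c * (δ + δ′)    ≡⟨ regroup′ Y c q δ δ′ ⟩
    Y + c * δ′ + c * (q + δ)      ∎)
    where
    open ≡-Reasoning
    regroup : ∀ X c p δ δ′ → X + c * δ + c * (p + δ′) ≡ (X + c * p) + c * (δ + δ′)
    regroup = solve-∀
    regroup′ : ∀ Y c q δ δ′ → (Y + c * q) + c * (δ + δ′) ≡ Y + c * δ′ + c * (q + δ)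
    regroup′ = solve-∀

  -- For n = 37 + k, a = fib n and b = fib (suc n) these are 5 V n and 5 (7 V n − 22 D₂ n);
  -- the shift by 37 makes all coefficients nonnegative.
  scaledV scaledGap : ℕ → ℕ → ℕ → ℕ
  scaledV   k a b = (532 * a + 454 * b) + k * (14 * a + 12 * b)
  scaledGap k a b = (160 * a + 1110 * b) + k * (10 * a + 40 * b)

  lowDefect highDefect : ℕ → ℕ → ℕ → ℕ → ℕ
  lowDefect  k a b δ  = 2 * k * quadratic 35640 46200 0 a b + quadratic 1389520 2060080 0 a b + k * k * (880 * δ)
  highDefect k a b δ′ = 2 * k * quadratic 0 0 17160 a b + quadratic 0 0 201520 a b + k * k * (880 * δ′)

  -- The slopes satisfy (10a + 40b)² − 5 (14a + 12b)² = 880 (b² − ab − a²) = ±880, so the k² term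
  -- of scaledGap² − 5 scaledV² is bounded and the defects are only of order k b².
  scaledGap-square : ∀ k a b δ δ′ → b * b + δ ≡ a * b + a * a + δ′ →
    scaledGap k a b * scaledGap k a b + lowDefect k a b δ ≡ 5 * (scaledV k a b * scaledV k a b) + highDefect k a b δ′
  scaledGap-square k a b δ δ′ cas = pencil-defect k P Q R S (880 * δ) (880 * δ′) _ _ _ _ slopes cross intercepts
    where
    P = 10 * a + 40 * b
    Q = 14 * a + 12 * b
    R = 160 * a + 1110 * b
    S = 532 * a + 454 * b
    slopes : P * P + 880 * δ ≡ 5 * (Q * Q) + 880 * δ′
    slopes = exchange-defect (P * P) (5 * (Q * Q)) 880 (a * b + a * a) (b * b) δ δ′ (identity a b) cas
      where
      identity : ∀ a b → (10 * a + 40 * b) * (10 * a + 40 * b) + 880 * (a * b + a * a)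
                         ≡ 5 * ((14 * a + 12 * b) * (14 * a + 12 * b)) + 880 * (b * b)
      identity = solve-∀
    cross : R * P + quadratic 35640 46200 0 a b ≡ 5 * (S * Q) + quadratic 0 0 17160 a b
    cross = trans (product+quadratic 160 1110 10 40 35640 46200 0 a b)
                  (sym (5*product+quadratic 532 454 14 12 0 0 17160 a b))
    intercepts : R * R + quadratic 1389520 2060080 0 a b ≡ 5 * (S * S) + quadratic 0 0 201520 a b
    intercepts = trans (product+quadratic 160 1110 160 1110 1389520 2060080 0 a b)
                       (sym (5*product+quadratic 532 454 532 454 0 0 201520 a b))

  defectConstant : ℕ
  defectConstant = 3651120

  defect-bound : ∀ k a b δ δ′ → a ≤ b → k ≤ b → 1 ≤ b → δ + δ′ ≡ 1 →
    lowDefect k a b δ + highDefect k a b δ′ ≤ defectConstant * (k + 1) * (b * b)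
  defect-bound k a b δ δ′ a≤b k≤b 1≤b δ+δ′≡1 = begin
    lowDefect k a b δ + highDefect k a b δ′
      ≡⟨ regroup k d₁ d₂ e₁ e₂ 880 δ δ′ ⟩
    2 * k * (d₁ + d₂) + (e₁ + e₂) + 880 * (k * k) * (δ + δ′)
      ≡⟨ cong₂ (λ x y → 2 * k * x + y + 880 * (k * k) * (δ + δ′))
               (quadratic-+ 35640 46200 0 0 0 17160 a b) (quadratic-+ 1389520 2060080 0 0 0 201520 a b) ⟩
    2 * k * quadratic 35640 46200 17160 a b + quadratic 1389520 2060080 201520 a b + 880 * (k * k) * (δ + δ′)
      ≡⟨ cong (λ z → 2 * k * quadratic 35640 46200 17160 a b + quadratic 1389520 2060080 201520 a b + 880 * (k * k) * z)
              δ+δ′≡1 ⟩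
    2 * k * quadratic 35640 46200 17160 a b + quadratic 1389520 2060080 201520 a b + 880 * (k * k) * 1
      ≤⟨ +-mono-≤ (+-mono-≤ (*-monoʳ-≤ (2 * k) (quadratic-bound 35640 46200 17160 a≤b))
                            (quadratic-bound 1389520 2060080 201520 a≤b))
                  (*-monoˡ-≤ 1 (*-monoʳ-≤ 880 k²≤kb²)) ⟩
    2 * k * (99000 * (b * b)) + 3651120 * (b * b) + 880 * (k * (b * b)) * 1
      ≡⟨ collect 99000 3651120 880 k (b * b) ⟩
    (198880 * k + 3651120) * (b * b)
      ≤⟨ *-monoˡ-≤ (b * b) (≤-trans (+-monoˡ-≤ 3651120 (*-monoˡ-≤ k (m≤m+n 198880 3452240)))
                                     (≤-reflexive (sym (*-distribˡ-+ defectConstant k 1)))) ⟩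
    defectConstant * (k + 1) * (b * b) ∎
    where
    open ≤-Reasoning
    d₁ = quadratic 35640 46200 0 a b
    d₂ = quadratic 0 0 17160 a b
    e₁ = quadratic 1389520 2060080 0 a b
    e₂ = quadratic 0 0 201520 a b
    k²≤kb² : k * k ≤ k * (b * b)
    k²≤kb² = *-monoʳ-≤ k (≤-trans k≤b (subst (_≤ b * b) (*-identityʳ b) (*-monoʳ-≤ b 1≤b)))
    regroup : ∀ k d₁ d₂ e₁ e₂ c δ δ′ → (2 * k * d₁ + e₁ + k * k * (c * δ)) + (2 * k * d₂ + e₂ + k * k * (c * δ′))
                                      ≡ 2 * k * (d₁ + d₂) + (e₁ + e₂) + c * (k * k) * (δ + δ′)
    regroup = solve-∀
    collect : ∀ p q c k z → 2 * k * (p * z) + q * z + c * (k * z) * 1 ≡ ((2 * p + c) * k + q) * z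
    collect = solve-∀

  scaledV-lower : ∀ k a b → (37 + k) * b ≤ scaledV k a b
  scaledV-lower k a b = subst ((37 + k) * b ≤_) (sym (split k a b)) (m≤m+n ((37 + k) * b) _)
    where
    split : ∀ k a b → (532 * a + 454 * b) + k * (14 * a + 12 * b) ≡ (37 + k) * b + (532 * a + 417 * b + k * (14 * a + 11 * b))
    split = solve-∀

  scaledV-nonZero : ∀ k a {b} → 1 ≤ b → NonZero (scaledV k a b)
  scaledV-nonZero k a {b} 1≤b = >-nonZero (≤-trans (*-mono-≤ (s≤s {0} {36 + k} z≤n) 1≤b) (scaledV-lower k a b))

  scaledV≤scaledGap : ∀ k {a b} → a ≤ b → scaledV k a b ≤ scaledGap k a b
  scaledV≤scaledGap k {a} {b} a≤b = subst (λ b → scaledV k a b ≤ scaledGap k a b) (m+[n∸m]≡n a≤b)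
    (subst (scaledV k a (a + d) ≤_) (sym (split k a d)) (m≤m+n (scaledV k a (a + d)) _))
    where
    d = b ∸ a
    split : ∀ k a d → (160 * a + 1110 * (a + d)) + k * (10 * a + 40 * (a + d))
                      ≡ ((532 * a + 454 * (a + d)) + k * (14 * a + 12 * (a + d))) + (284 * a + 656 * d + k * (24 * a + 28 * d))
    split = solve-∀

  near√5-scaled : ∀ B k a b δ δ′ → a ≤ b → k ≤ b → 1 ≤ b → δ + δ′ ≡ 1 → b * b + δ ≡ a * b + a * a + δ′ →
    B * defectConstant ≤ k → Near√5 B (scaledGap k a b) (scaledV k a b)
  near√5-scaled B k a b δ δ′ a≤b k≤b 1≤b δ+δ′≡1 cas BM≤k =
    near√5-byDefect B (scaledGap k a b) U (lowDefect k a b δ) (highDefect k a b δ′) (scaledGap-square k a b δ δ′ cas) (begin-strict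
      B * (lowDefect k a b δ + highDefect k a b δ′)  ≤⟨ *-monoʳ-≤ B (defect-bound k a b δ δ′ a≤b k≤b 1≤b δ+δ′≡1) ⟩
      B * (defectConstant * (k + 1) * (b * b))     ≡⟨ reassoc B defectConstant (k + 1) (b * b) ⟩
      B * defectConstant * (k + 1) * (b * b)       ≤⟨ *-monoˡ-≤ (b * b) (*-monoˡ-≤ (k + 1) BM≤k) ⟩
      k * (k + 1) * (b * b)                        <⟨ *-monoˡ-< (b * b) {{b²≢0}} (k[k+1]<[37+k]² k) ⟩
      (37 + k) * (37 + k) * (b * b)                ≡⟨ square-product (37 + k) b ⟩
      ((37 + k) * b) * ((37 + k) * b)              ≤⟨ *-mono-≤ (scaledV-lower k a b) (scaledV-lower k a b) ⟩
      U * U                                        ≤⟨ m≤n*m (U * U) 22 ⟩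
      22 * (U * U)                                 ∎)
    where
    open ≤-Reasoning
    U = scaledV k a b
    b²≢0 : NonZero (b * b)
    b²≢0 = >-nonZero (*-mono-≤ 1≤b 1≤b)
    reassoc : ∀ x y z w → x * (y * z * w) ≡ x * y * z * w
    reassoc = solve-∀
    square-product : ∀ x y → x * x * (y * y) ≡ (x * y) * (x * y)
    square-product = solve-∀
    k[k+1]<[37+k]² : ∀ k → k * (k + 1) < (37 + k) * (37 + k)
    k[k+1]<[37+k]² k = subst (k * (k + 1) <_) (sym (expand k)) (s≤s (m≤m+n (k * (k + 1)) (73 * k + 1368)))
      where
      expand : ∀ k → (37 + k) * (37 + k) ≡ suc (k * (k + 1) + (73 * k + 1368))
      expand = solve-∀

  near√5-fib : ∀ B k n → k ≤ n → B * defectConstant ≤ k →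
    Near√5 B (scaledGap k (fib n) (fib (suc n))) (scaledV k (fib n) (fib (suc n)))
  near√5-fib B k n k≤n BM≤k with cassini n
  ... | δ , δ′ , δ+δ′≡1 , cas =
    near√5-scaled B k (fib n) (fib (suc n)) δ δ′ (fib-mono n) (≤-trans k≤n (n≤fib-suc n)) (fib-suc-pos n) δ+δ′≡1 cas BM≤k

  5*V≡scaledV : ∀ k → 5 * V (37 + k) ≡ scaledV k (fib (37 + k)) (fib (suc (37 + k)))
  5*V≡scaledV k = trans (5*V≡fibLinear (36 + k)) (shift k (fib (37 + k)) (fib (suc (37 + k))))
    where
    shift : ∀ k a b → (37 + k) * (14 * a + 12 * b) + 14 * a + 10 * b ≡ (532 * a + 454 * b) + k * (14 * a + 12 * b)
    shift = solve-∀

  7*5V≡22*5D₂+scaledGap : ∀ k → 7 * (5 * V (37 + k)) ≡ 22 * (5 * D₂ (37 + k)) + scaledGap k (fib (37 + k)) (fib (suc (37 + k)))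
  7*5V≡22*5D₂+scaledGap k = begin
    7 * (5 * V (37 + k))                    ≡⟨ cong (7 *_) (5*V≡fibLinear (36 + k)) ⟩
    7 * fibLinear 14 12 14 10 (37 + k)      ≡⟨ split k (fib (37 + k)) (fib (suc (37 + k))) ⟩
    22 * fibLinear 4 2 14 20 (37 + k) + scaledGap k (fib (37 + k)) (fib (suc (37 + k)))
                                            ≡⟨ cong (λ z → 22 * z + scaledGap k (fib (37 + k)) (fib (suc (37 + k)))) (5*D₂≡fibLinear (36 + k)) ⟨
    22 * (5 * D₂ (37 + k)) + scaledGap k (fib (37 + k)) (fib (suc (37 + k))) ∎
    where
    open ≡-Reasoning
    split : ∀ k a b → 7 * ((37 + k) * (14 * a + 12 * b) + 14 * a + 10 * b)
                      ≡ 22 * ((37 + k) * (4 * a + 2 * b) + 14 * a + 20 * b) + ((160 * a + 1110 * b) + k * (10 * a + 40 * b))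
    split = solve-∀

module Root5Cut where

  open import Data.Nat as ℕ using (ℕ; zero; suc)
  import Data.Nat.Properties as ℕ
  open import Data.Integer as ℤ using (+_)
  import Data.Integer.Properties as ℤ
  open import Data.Integer.Tactic.RingSolver using (solve-∀)
  open import Data.Rational
  open import Data.Rational.Properties
  import Data.Rational.Unnormalised as ℚᵘ
  import Data.Rational.Unnormalised.Properties as ℚᵘ
  open import Data.Rational.Solver using (module +-*-Solver)
  open import Data.Product using (_×_; _,_; proj₁; proj₂)
  open import Data.Sum using (inj₁; inj₂)
  open import Relation.Nullary using (yes; no; contradiction)
  open import Relation.Binary.PropositionalEquality
  open Asymptotics using (Near√5; near√5-bracket)

  ι : ℕ → ℚ
  ι m = + m / 1

  toℚᵘ-ι : ∀ m → toℚᵘ (ι m) ℚᵘ.≃ ℚᵘ.mkℚᵘ (+ m) 0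
  toℚᵘ-ι m = toℚᵘ-fromℚᵘ (ℚᵘ.mkℚᵘ (+ m) 0)

  ι-+ : ∀ m n → ι (m ℕ.+ n) ≡ ι m + ι n
  ι-+ m n = toℚᵘ-injective (ℚᵘ.≃-trans (toℚᵘ-ι (m ℕ.+ n)) (ℚᵘ.≃-sym (ℚᵘ.≃-trans (toℚᵘ-homo-+ (ι m) (ι n))
    (ℚᵘ.≃-trans (ℚᵘ.+-cong (toℚᵘ-ι m) (toℚᵘ-ι n)) (ℚᵘ.*≡* (cross-multiply (+ m) (+ n)))))))
    where
    cross-multiply : ∀ a b → (a ℤ.* + 1 ℤ.+ b ℤ.* + 1) ℤ.* + 1 ≡ (a ℤ.+ b) ℤ.* + 1
    cross-multiply = solve-∀

  ι-* : ∀ m n → ι (m ℕ.* n) ≡ ι m * ι n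
  ι-* m n = toℚᵘ-injective (ℚᵘ.≃-trans (toℚᵘ-ι (m ℕ.* n)) (ℚᵘ.≃-sym (ℚᵘ.≃-trans (toℚᵘ-homo-* (ι m) (ι n))
    (ℚᵘ.≃-trans (ℚᵘ.*-cong (toℚᵘ-ι m) (toℚᵘ-ι n)) (ℚᵘ.*≡* (cong (ℤ._* + 1) (sym (ℤ.pos-* m n))))))))

  ι-< : ∀ {m n} → m ℕ.< n → ι m < ι n
  ι-< {m} {n} m<n = toℚᵘ-cancel-< (ℚᵘ.<-respˡ-≃ (ℚᵘ.≃-sym (toℚᵘ-ι m)) (ℚᵘ.<-respʳ-≃ (ℚᵘ.≃-sym (toℚᵘ-ι n))
    (ℚᵘ.*<* (subst₂ ℤ._<_ (sym (ℤ.*-identityʳ (+ m))) (sym (ℤ.*-identityʳ (+ n))) (ℤ.+<+ m<n)))))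

  *-cancelʳ-<-ι : ∀ m {p q} → p * ι m < q * ι m → p < q
  *-cancelʳ-<-ι m = *-cancelʳ-<-nonNeg (ι m) {{normalize-nonNeg m 1}}

  *-ι-denominator : ∀ p a d → toℚᵘ p ℚᵘ.≃ ℚᵘ.mkℚᵘ (+ a) d → p * ι (suc d) ≡ ι a
  *-ι-denominator p a d p≃a/d = toℚᵘ-injective (ℚᵘ.≃-trans (toℚᵘ-homo-* p (ι (suc d)))
    (ℚᵘ.≃-trans (ℚᵘ.*-cong p≃a/d (toℚᵘ-ι (suc d)))
    (ℚᵘ.≃-trans (ℚᵘ.*≡* (ℤ.*-assoc (+ a) (+ suc d) (+ 1))) (ℚᵘ.≃-sym (toℚᵘ-ι a)))))

  /-*-ι : ∀ a d .{{_ : ℕ.NonZero d}} → (+ a / d) * ι d ≡ ι a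
  /-*-ι a (suc d) = *-ι-denominator (+ a / suc d) a d (toℚᵘ-fromℚᵘ (ℚᵘ.mkℚᵘ (+ a) d))

  *-ι-scale : ∀ r c {v d} → r * ι v ≡ ι d → r * ι (c ℕ.* v) ≡ ι (c ℕ.* d)
  *-ι-scale r c {v} {d} rv≡d = begin
    r * ι (c ℕ.* v)     ≡⟨ cong (r *_) (ι-* c v) ⟩
    r * (ι c * ι v)     ≡⟨ *-assoc r (ι c) (ι v) ⟨
    (r * ι c) * ι v     ≡⟨ cong (_* ι v) (*-comm r (ι c)) ⟩
    (ι c * r) * ι v     ≡⟨ *-assoc (ι c) r (ι v) ⟩
    ι c * (r * ι v)     ≡⟨ cong (ι c *_) rv≡d ⟩
    ι c * ι d           ≡⟨ ι-* c d ⟨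
    ι (c ℕ.* d)         ∎
    where open ≡-Reasoning

  square-scaling : ∀ q w x → q * ι w ≡ ι x → (q * q) * ι (w ℕ.* w) ≡ ι (x ℕ.* x)
  square-scaling q w x qw≡x = begin
    (q * q) * ι (w ℕ.* w)      ≡⟨ cong ((q * q) *_) (ι-* w w) ⟩
    (q * q) * (ι w * ι w)      ≡⟨ interchange q (ι w) ⟩
    (q * ι w) * (q * ι w)      ≡⟨ cong₂ _*_ qw≡x qw≡x ⟩
    ι x * ι x                  ≡⟨ ι-* x x ⟨
    ι (x ℕ.* x)                ∎
    where
    open ≡-Reasoning
    interchange : ∀ (q w : ℚ) → (q * q) * (w * w) ≡ (q * w) * (q * w)
    interchange = +-*-Solver.solve 2 (λ q w → (q :* q) :* (w :* w) := (q :* w) :* (q :* w)) refl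
      where open +-*-Solver

  <√5-byScaling : ∀ q w x k → q * ι w ≡ ι x - ι k → (∀ z → x ≡ z ℕ.+ k → z ℕ.* z ℕ.< 5 ℕ.* (w ℕ.* w)) → q <√5
  <√5-byScaling q w x k qw≡x-k below with x ℕ.<? k
  ... | yes x<k = inj₁ (*-cancelʳ-<-ι w (begin-strict
    q * ι w          ≡⟨ qw≡x-k ⟩
    ι x - ι k        <⟨ +-monoˡ-< (- ι k) (ι-< x<k) ⟩
    ι k - ι k        ≡⟨ +-inverseʳ (ι k) ⟩
    0ℚ               ≡⟨ *-zeroˡ (ι w) ⟨
    0ℚ * ι w         ∎))
    where open ≤-Reasoning
  ... | no x≮k = inj₂ (*-cancelʳ-<-ι (w ℕ.* w) (begin-strict
    (q * q) * ι (w ℕ.* w)    ≡⟨ square-scaling q w z qw≡z ⟩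
    ι (z ℕ.* z)              <⟨ ι-< (below z x≡z+k) ⟩
    ι (5 ℕ.* (w ℕ.* w))      ≡⟨ ι-* 5 (w ℕ.* w) ⟩
    ℚ5 * ι (w ℕ.* w)         ∎))
    where
    open ≤-Reasoning
    z = x ℕ.∸ k
    x≡z+k : x ≡ z ℕ.+ k
    x≡z+k = sym (ℕ.m∸n+n≡m (ℕ.≮⇒≥ x≮k))
    qw≡z : q * ι w ≡ ι z
    qw≡z = trans qw≡x-k (trans (cong (λ y → ι y - ι k) x≡z+k) (trans (cong (_- ι k) (ι-+ z k)) (cancel (ι z) (ι k))))
      where
      cancel : ∀ (a b : ℚ) → (a + b) - b ≡ a
      cancel = +-*-Solver.solve 2 (λ a b → (a :+ b) :- b := a) refl
        where open +-*-Solver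

  √5<-byScaling : ∀ q w y → q * ι w ≡ ι y → 5 ℕ.* (w ℕ.* w) ℕ.< y ℕ.* y → √5< q
  √5<-byScaling q w zero    qw≡y above = contradiction above ℕ.n≮0
  √5<-byScaling q w y@(suc _) qw≡y above = q-positive , square-above
    where
    open ≤-Reasoning
    q-positive : 0ℚ < q
    q-positive = *-cancelʳ-<-ι w (begin-strict
      0ℚ * ι w    ≡⟨ *-zeroˡ (ι w) ⟩
      ι 0         <⟨ ι-< {0} {y} ℕ.z<s ⟩
      ι y         ≡⟨ qw≡y ⟨
      q * ι w     ∎)
    square-above : ℚ5 < q * q
    square-above = *-cancelʳ-<-ι (w ℕ.* w) (begin-strict
      ℚ5 * ι (w ℕ.* w)      ≡⟨ ι-* 5 (w ℕ.* w) ⟨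
      ι (5 ℕ.* (w ℕ.* w))   <⟨ ι-< above ⟩
      ι (y ℕ.* y)           ≡⟨ square-scaling q w y qw≡y ⟨
      (q * q) * ι (w ℕ.* w) ∎)

  gap-scaling : ∀ r σ {v b d t : ℚ} {σb : ℚ} → r * v ≡ d → σ * b ≡ σb → ℚ7 * v ≡ ℚ22 * d + t →
    (ℚ7 - ℚ22 * (r + σ)) * (v * b) ≡ t * b - ℚ22 * σb * v
  gap-scaling r σ {v} {b} {d} {t} {σb} rv≡d σb≡σb 7v≡22d+t = begin
    (ℚ7 - ℚ22 * (r + σ)) * (v * b)                        ≡⟨ expand ℚ7 ℚ22 r σ v b ⟩
    (ℚ7 * v) * b - ℚ22 * (r * v) * b - ℚ22 * (σ * b) * v   ≡⟨ cong₂ (λ x y → x * b - ℚ22 * y * b - ℚ22 * (σ * b) * v) 7v≡22d+t rv≡d ⟩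
    (ℚ22 * d + t) * b - ℚ22 * d * b - ℚ22 * (σ * b) * v    ≡⟨ cong (λ z → (ℚ22 * d + t) * b - ℚ22 * d * b - ℚ22 * z * v) σb≡σb ⟩
    (ℚ22 * d + t) * b - ℚ22 * d * b - ℚ22 * σb * v         ≡⟨ cancel ℚ22 d t b σb v ⟩
    t * b - ℚ22 * σb * v                                   ∎
    where
    open ≡-Reasoning
    open +-*-Solver
    expand : ∀ (c₇ c₂₂ r σ v b : ℚ) → (c₇ - c₂₂ * (r + σ)) * (v * b) ≡ (c₇ * v) * b - c₂₂ * (r * v) * b - c₂₂ * (σ * b) * v
    expand = solve 6 (λ c₇ c₂₂ r σ v b → (c₇ :- c₂₂ :* (r :+ σ)) :* (v :* b)
                                       := (c₇ :* v) :* b :- c₂₂ :* (r :* v) :* b :- c₂₂ :* (σ :* b) :* v) refl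
    cancel : ∀ (c₂₂ d t b σb v : ℚ) → (c₂₂ * d + t) * b - c₂₂ * d * b - c₂₂ * σb * v ≡ t * b - c₂₂ * σb * v
    cancel = solve 6 (λ c₂₂ d t b σb v → (c₂₂ :* d :+ t) :* b :- c₂₂ :* d :* b :- c₂₂ :* σb :* v
                                       := t :* b :- c₂₂ :* σb :* v) refl

  -- With x = 7 − 22 r = t / v and e = 22 ε = 22 a / b, WithinL ε r says x − e < √5 < x + e;
  -- multiplied by v b these become the inequalities of near√5-bracket.
  withinL-byScaling : ∀ r ε v d t a b .{{_ : ℕ.NonZero b}} → r * ι v ≡ ι d → ε * ι b ≡ ι a →
    7 ℕ.* v ≡ 22 ℕ.* d ℕ.+ t → 1 ℕ.≤ a → v ℕ.≤ t → Near√5 b t v → WithinL ε r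
  withinL-byScaling r ε v d t a b rv≡d εb≡a 7v≡22d+t 1≤a v≤t near =
    <√5-byScaling (ℚ7 - ℚ22 * (r + ε)) (v ℕ.* b) (t ℕ.* b) (22 ℕ.* a ℕ.* v) lower-scaled lower ,
    √5<-byScaling (ℚ7 - ℚ22 * (r - ε)) (v ℕ.* b) (t ℕ.* b ℕ.+ 22 ℕ.* a ℕ.* v) upper-scaled upper
    where
    open ≡-Reasoning
    bracket = near√5-bracket b t v a 1≤a v≤t near
    lower = proj₁ bracket
    upper = proj₂ bracket
    7v≡22d+t′ : ℚ7 * ι v ≡ ℚ22 * ι d + ι t
    7v≡22d+t′ = begin
      ℚ7 * ι v              ≡⟨ ι-* 7 v ⟨
      ι (7 ℕ.* v)           ≡⟨ cong ι 7v≡22d+t ⟩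
      ι (22 ℕ.* d ℕ.+ t)    ≡⟨ ι-+ (22 ℕ.* d) t ⟩
      ι (22 ℕ.* d) + ι t    ≡⟨ cong (_+ ι t) (ι-* 22 d) ⟩
      ℚ22 * ι d + ι t       ∎
    ι-22av : ι (22 ℕ.* a ℕ.* v) ≡ ℚ22 * ι a * ι v
    ι-22av = trans (ι-* (22 ℕ.* a) v) (cong (_* ι v) (ι-* 22 a))
    lower-scaled : (ℚ7 - ℚ22 * (r + ε)) * ι (v ℕ.* b) ≡ ι (t ℕ.* b) - ι (22 ℕ.* a ℕ.* v)
    lower-scaled = begin
      (ℚ7 - ℚ22 * (r + ε)) * ι (v ℕ.* b)      ≡⟨ cong ((ℚ7 - ℚ22 * (r + ε)) *_) (ι-* v b) ⟩
      (ℚ7 - ℚ22 * (r + ε)) * (ι v * ι b)      ≡⟨ gap-scaling r ε rv≡d εb≡a 7v≡22d+t′ ⟩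
      ι t * ι b - ℚ22 * ι a * ι v             ≡⟨ cong₂ _-_ (ι-* t b) ι-22av ⟨
      ι (t ℕ.* b) - ι (22 ℕ.* a ℕ.* v)        ∎
    upper-scaled : (ℚ7 - ℚ22 * (r - ε)) * ι (v ℕ.* b) ≡ ι (t ℕ.* b ℕ.+ 22 ℕ.* a ℕ.* v)
    upper-scaled = begin
      (ℚ7 - ℚ22 * (r - ε)) * ι (v ℕ.* b)      ≡⟨ cong ((ℚ7 - ℚ22 * (r - ε)) *_) (ι-* v b) ⟩
      (ℚ7 - ℚ22 * (r - ε)) * (ι v * ι b)      ≡⟨ gap-scaling r (- ε) rv≡d (trans (sym (neg-distribˡ-* ε (ι b))) (cong -_ εb≡a)) 7v≡22d+t′ ⟩
      ι t * ι b - ℚ22 * (- ι a) * ι v         ≡⟨ double-negation (ι t * ι b) ℚ22 (ι a) (ι v) ⟩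
      ι t * ι b + ℚ22 * ι a * ι v             ≡⟨ cong₂ _+_ (ι-* t b) ι-22av ⟨
      ι (t ℕ.* b) + ι (22 ℕ.* a ℕ.* v)        ≡⟨ ι-+ (t ℕ.* b) (22 ℕ.* a ℕ.* v) ⟨
      ι (t ℕ.* b ℕ.+ 22 ℕ.* a ℕ.* v)          ∎
      where
      double-negation : ∀ (x c y z : ℚ) → x - c * (- y) * z ≡ x + c * y * z
      double-negation = +-*-Solver.solve 4 (λ x c y z → x :- c :* (:- y) :* z := x :+ c :* y :* z) refl
        where open +-*-Solver

open import Data.Nat using (ℕ; zero; suc; _+_; _*_; _∸_; _≤_; _≥_; s≤s; z≤n; NonZero)
open import Data.Nat.Properties using (m≤m+n; m≤n+m; m+[n∸m]≡n; m+n∸m≡n; ∸-monoˡ-≤; ≤-trans; m*n≢0⇒n≢0)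
open import Data.Integer using (+_; +<+; -[1+_])
open import Data.Rational using (ℚ; _<_; 0ℚ; _/_; mkℚ; *<*)
import Data.Rational.Unnormalised.Properties as ℚᵘ
open import Data.Nat.Coprimality using (Coprime)
open import Data.Product using (Σ; ∃-syntax; _,_)
open import Relation.Binary.PropositionalEquality using (_≡_; subst; sym)
open Counting using (fib)
open Asymptotics
open Root5Cut

eventually-from-offset : ∀ (P : ℕ → Set) m K → (∀ k → K ≤ k → P (m + k)) → ∃[ N ] (∀ n → n ≥ N → P n)
eventually-from-offset P m K shifted = m + K , λ n n≥m+K →
  subst P (m+[n∸m]≡n (≤-trans (m≤m+n m K) n≥m+K)) (shifted (n ∸ m) (subst (_≤ n ∸ m) (m+n∸m≡n m K) (∸-monoˡ-≤ m n≥m+K)))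

D₂/V-withinL : ∀ k a′ b′ .(c : Coprime (suc a′) (suc b′)) → suc b′ * defectConstant ≤ k →
  Σ (NonZero (V (37 + k))) λ nz → WithinL (mkℚ (+ suc a′) b′ c) (((+ D₂ (37 + k)) / V (37 + k)) {{nz}})
D₂/V-withinL k a′ b′ c BM≤k = V≢0 ,
  withinL-byScaling r ε (5 * V n) (5 * D₂ n) T (suc a′) (suc b′)
    (*-ι-scale r 5 {V n} {D₂ n} (/-*-ι (D₂ n) (V n) {{V≢0}})) (*-ι-denominator ε (suc a′) b′ ℚᵘ.≃-refl)
    (7*5V≡22*5D₂+scaledGap k) (s≤s z≤n)
    (subst (_≤ T) (sym 5V≡U) (scaledV≤scaledGap k {a} {b} (fib-mono n)))
    (subst (Near√5 (suc b′) T) (sym 5V≡U) (near√5-fib (suc b′) k n (m≤n+m k 37) BM≤k))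
  where
  n = 37 + k
  a = fib n
  b = fib (suc n)
  T = scaledGap k a b
  ε = mkℚ (+ suc a′) b′ c
  5V≡U : 5 * V n ≡ scaledV k a b
  5V≡U = 5*V≡scaledV k
  V≢0 : NonZero (V n)
  V≢0 = m*n≢0⇒n≢0 5 {{subst NonZero (sym 5V≡U) (scaledV-nonZero k a (fib-suc-pos n))}}
  r = ((+ D₂ n) / V n) {{V≢0}}

theorem3p9 : (ε : ℚ) → 0ℚ < ε →
    ∃[ N ] ((n : ℕ) → n ≥ N → Σ (NonZero (V n)) (λ nz → WithinL ε (((+ D₂ n) / V n) {{nz}})))
theorem3p9 (mkℚ (+ suc a′) b′ c) _ =
  eventually-from-offset (λ n → Σ (NonZero (V n)) λ nz → WithinL (mkℚ (+ suc a′) b′ c) (((+ D₂ n) / V n) {{nz}}))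
                         37 (suc b′ * defectConstant) (λ k → D₂/V-withinL k a′ b′ c)
theorem3p9 (mkℚ (+ zero) _ _)   (*<* (+<+ ()))
theorem3p9 (mkℚ -[1+ _ ] _ _) (*<* ())
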